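{- For every integer $q \geq 2$, the limit defining the constant $C_q = \inf_{n \geq 1} \sqrt[n]{f(n,q)}$ satisfies $f(n,q) = C_q^{(1+o(1))n}$ as $n \to \infty$. Moreover, the sequence $(C_q)_{q \geq 2}$ is non-increasing.
   Context: For integers $n \geq 1$ and $q \geq 2$, let $\mathbb Z_q = \mathbb Z/q\mathbb Z$ and consider $\mathbb Z_q^n$ with the Hamming distance $d(x,y)$ = number of coordinates in which $x$ and $y$ differ. Say $x$ skirts $y$ if $d(x,y) = n$ (i.e. $x$ and $y$ differ in every coordinate). A set $S \subseteq \mathbb Z_q^n$ is a skirting set if every $y \in \mathbb Z_q^n$ is skirted by some $x \in S$. Let $f(n,q)$ denote the minimum size of a skirting set in $\mathbb Z_q^n$. The notation $g(n) = o(h(n))$ means $\lim_{n\to\infty} g(n)/h(n) = 0$. -}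

module Defs where

open import Data.Nat using (ℕ; suc; _+_; _*_; _^_; _≤_)
open import Data.Fin using (Fin)
open import Data.List using (List; length)
open import Data.List.Membership.Propositional using (_∈_)
open import Data.Product using (Σ; ∃; ∃-syntax; _×_)
open import Relation.Binary.PropositionalEquality using (_≡_; _≢_)

-- Z_q^n, represented as functions Fin n → Fin q (Fin q ≅ Z/qZ as a set;
-- only equality of coordinates matters for Hamming distance).
Word : ℕ → ℕ → Set
Word n q = Fin n → Fin q

Skirts : ∀ {n q} → Word n q → Word n q → Set
Skirts {n} x y = (i : Fin n) → x i ≢ y i

IsSkirting : ∀ n q → List (Word n q) → Set
IsSkirting n q S = (y : Word n q) → ∃[ x ] (x ∈ S × Skirts x y)

-- k = f(n,q): k is the minimum size of a skirting set.  (Minimising the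
-- length over lists is the same as minimising the cardinality over sets,
-- since removing duplicates keeps a list skirting.)
IsMinSkirtingSize : ℕ → ℕ → ℕ → Set
IsMinSkirtingSize n q k =
  (∃[ S ] (IsSkirting n q S × length S ≡ k)) ×
  ((S : List (Word n q)) → IsSkirting n q S → k ≤ length S)

-- RootLe≈ g n h m k  encodes the real inequality
--   g(n)^(1/n) ≤ h(m)^(1/m) · (1 + 1/k)
-- after raising to the power n·m and clearing denominators:
--   g(n)^m · k^(n m) ≤ h(m)^n · (k+1)^(n m).
RootLe≈ : (ℕ → ℕ) → ℕ → (ℕ → ℕ) → ℕ → ℕ → Set
RootLe≈ g n h m k = g n ^ m * k ^ (n * m) ≤ h m ^ n * suc k ^ (n * m)

-- g(n)^(1/n) → inf_{m ≥ 1} g(m)^(1/m) as n → ∞.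
-- (Since inf ≤ g(n)^(1/n) always, convergence to the infimum is exactly:
--  for every m ≥ 1 and every ε = 1/k, eventually g(n)^(1/n) ≤ g(m)^(1/m)(1+ε).)
RootLimitIsInf : (ℕ → ℕ) → Set
RootLimitIsInf g =
  (m : ℕ) → 1 ≤ m → (k : ℕ) → 1 ≤ k →
  ∃[ N ] ((n : ℕ) → N ≤ n → 1 ≤ n → RootLe≈ g n g m k)

-- inf_{n ≥ 1} g(n)^(1/n) ≤ inf_{m ≥ 1} h(m)^(1/m).
RootInfLe : (ℕ → ℕ) → (ℕ → ℕ) → Set
RootInfLe g h =
  (m : ℕ) → 1 ≤ m → (k : ℕ) → 1 ≤ k →
  ∃[ n ] (1 ≤ n × RootLe≈ g n h m k)

module Submission where

open import Defs
open import Data.Nat using (ℕ; zero; suc; _+_; _*_; _^_; _≤_; z≤n; s≤s; _/_; _%_; >-nonZero)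
open import Data.Nat.Properties
open import Data.Nat.DivMod using (m≡m%n+[m/n]*n; m%n<n)
open import Data.Nat.Tactic.RingSolver using (solve-∀)
open import Algebra.Properties.CommutativeSemigroup *-commutativeSemigroup
  using () renaming (interchange to *-interchange)
open import Data.Fin using (zero; suc; splitAt; pinch)
open import Data.Fin.Properties using (splitAt⁻¹-↑ˡ; splitAt⁻¹-↑ʳ)
open import Data.Vec.Functional using (_++_; take; drop)
open import Data.List using (List; []; _∷_; length; map; cartesianProductWith)
open import Data.List.Properties using (length-map; length-++)
open import Data.List.Membership.Propositional.Properties
  using (∈-length; ∈-map⁺; ∈-cartesianProductWith⁺)
open import Data.Product using (_×_; _,_; proj₁; proj₂; ∃-syntax)
open import Data.Sum using (inj₁; inj₂)
open import Function using (_∘_)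
open import Relation.Binary.PropositionalEquality

-- Concatenating words turns skirting sets S ⊆ Z_q^m and T ⊆ Z_q^n into a
-- skirting set S × T ⊆ Z_q^(m+n), so n ↦ f(n,q) is submultiplicative and
-- Fekete's lemma applies: writing n = a m + r with 1 ≤ r ≤ m gives
-- f(n) ≤ f(m)^a f(1)^m, and the constant f(1)^m is swamped by (1 + 1/k)^n
-- once n is large, by Bernoulli's inequality.  For monotonicity in q, a
-- skirting set of Z_q^n shifted by one in every coordinate skirts Z_(q+1)^n:
-- to skirt y, skirt the word obtained from y by merging the symbols 0 and 1.

^-distribʳ-* : ∀ m n o → (m * n) ^ o ≡ m ^ o * n ^ o
^-distribʳ-* m n zero = refl
^-distribʳ-* m n (suc o) = begin
  m * n * (m * n) ^ o      ≡⟨ cong (m * n *_) (^-distribʳ-* m n o) ⟩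
  m * n * (m ^ o * n ^ o)  ≡⟨ *-interchange m n (m ^ o) (n ^ o) ⟩
  m * m ^ o * (n * n ^ o)  ∎
  where open ≡-Reasoning

-- (1 + 1/k)^j ≥ 1 + j/k, with denominators cleared.
bernoulli : ∀ k j → k ^ j * (k + j) ≤ suc k ^ j * k
bernoulli k zero = ≤-reflexive (cong (_+ 0) (+-identityʳ k))
bernoulli k (suc j) = begin
  k * k ^ j * (k + suc j)    ≡⟨ rearrange₁ k (k ^ j) (k + suc j) ⟩
  k ^ j * (k * (k + suc j))  ≤⟨ *-monoʳ-≤ (k ^ j) (≤-trans (m≤m+n _ j) (≤-reflexive (expand k j))) ⟩
  k ^ j * ((k + j) * suc k)  ≡⟨ *-assoc (k ^ j) (k + j) (suc k) ⟨
  k ^ j * (k + j) * suc k    ≤⟨ *-monoˡ-≤ (suc k) (bernoulli k j) ⟩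
  suc k ^ j * k * suc k      ≡⟨ rearrange₂ (suc k ^ j) k (suc k) ⟩
  suc k * suc k ^ j * k      ∎
  where
  open ≤-Reasoning
  rearrange₁ : ∀ a b c → a * b * c ≡ b * (a * c)
  rearrange₁ = solve-∀
  expand : ∀ k j → k * (k + suc j) + j ≡ (k + j) * suc k
  expand = solve-∀
  rearrange₂ : ∀ a b c → a * b * c ≡ c * a * b
  rearrange₂ = solve-∀

d*k^t≤[1+k]^t : ∀ k d t → 1 ≤ k → k * d ≤ t → d * k ^ t ≤ suc k ^ t
d*k^t≤[1+k]^t k@(suc _) d t _ kd≤t = *-cancelʳ-≤ (d * k ^ t) (suc k ^ t) k (begin
  d * k ^ t * k    ≡⟨ rearrange d (k ^ t) k ⟩
  k ^ t * (k * d)  ≤⟨ *-monoʳ-≤ (k ^ t) (≤-trans kd≤t (m≤n+m t k)) ⟩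
  k ^ t * (k + t)  ≤⟨ bernoulli k t ⟩
  suc k ^ t * k    ∎)
  where
  open ≤-Reasoning
  rearrange : ∀ a b c → a * b * c ≡ b * (c * a)
  rearrange = solve-∀

module Fekete (g : ℕ → ℕ)
  (g-pos : ∀ n → 1 ≤ n → 1 ≤ g n)
  (g-submult : ∀ m n → 1 ≤ m → 1 ≤ n → g (m + n) ≤ g m * g n) where

  g≤g[1]^n : ∀ n → 1 ≤ n → g n ≤ g 1 ^ n
  g≤g[1]^n (suc zero) _ = ≤-reflexive (sym (*-identityʳ (g 1)))
  g≤g[1]^n (suc (suc n)) _ =
    ≤-trans (g-submult 1 (suc n) ≤-refl (s≤s z≤n)) (*-monoʳ-≤ (g 1) (g≤g[1]^n (suc n) (s≤s z≤n)))

  g[a*m+r]≤g[m]^a*g[r] : ∀ m a r → 1 ≤ m → 1 ≤ r → g (a * m + r) ≤ g m ^ a * g r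
  g[a*m+r]≤g[m]^a*g[r] m zero r _ _ = ≤-reflexive (sym (*-identityˡ (g r)))
  g[a*m+r]≤g[m]^a*g[r] m (suc a) r 1≤m 1≤r = begin
    g (m + a * m + r)      ≡⟨ cong g (+-assoc m (a * m) r) ⟩
    g (m + (a * m + r))    ≤⟨ g-submult m (a * m + r) 1≤m (≤-trans 1≤r (m≤n+m r (a * m))) ⟩
    g m * g (a * m + r)    ≤⟨ *-monoʳ-≤ (g m) (g[a*m+r]≤g[m]^a*g[r] m a r 1≤m 1≤r) ⟩
    g m * (g m ^ a * g r)  ≡⟨ *-assoc (g m) (g m ^ a) (g r) ⟨
    g m ^ suc a * g r      ∎
    where open ≤-Reasoning

  -- Divide n − 1 rather than n by m, so that the remainder r lies in 1 … m,
  -- where the hypotheses control g r.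
  g≤g[m]^a*g[1]^m : ∀ m n → 1 ≤ m → 1 ≤ n → ∃[ a ] (a * m ≤ n × g n ≤ g m ^ a * g 1 ^ m)
  g≤g[m]^a*g[1]^m m@(suc _) (suc n) 1≤m _ =
    a , subst (a * m ≤_) (sym n≡a*m+r) (m≤m+n (a * m) r) ,
    subst (λ n → g n ≤ g m ^ a * g 1 ^ m) (sym n≡a*m+r)
      (≤-trans (g[a*m+r]≤g[m]^a*g[r] m a r 1≤m (s≤s z≤n)) (*-monoʳ-≤ (g m ^ a) g[r]≤g[1]^m))
    where
    a r : ℕ
    a = n / m
    r = suc (n % m)
    n≡a*m+r : suc n ≡ a * m + r
    n≡a*m+r = trans (cong suc (m≡m%n+[m/n]*n n m)) (+-comm r (a * m))
    g[r]≤g[1]^m : g r ≤ g 1 ^ m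
    g[r]≤g[1]^m = ≤-trans (g≤g[1]^n r (s≤s z≤n)) (^-monoʳ-≤ (g 1) {{>-nonZero (g-pos 1 ≤-refl)}} (m%n<n n m))

  fekete : RootLimitIsInf g
  fekete m@(suc _) 1≤m k 1≤k = k * d , bound
    where
    d : ℕ
    d = g 1 ^ (m * m)
    bound : ∀ n → k * d ≤ n → 1 ≤ n → RootLe≈ g n g m k
    bound n kd≤n 1≤n with g≤g[m]^a*g[1]^m m n 1≤m 1≤n
    ... | a , a*m≤n , gn≤ = begin
      g n ^ m * k ^ (n * m)                   ≤⟨ *-monoˡ-≤ (k ^ (n * m)) (^-monoˡ-≤ m gn≤) ⟩
      (g m ^ a * g 1 ^ m) ^ m * k ^ (n * m)   ≡⟨ cong (_* k ^ (n * m)) power-out ⟩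
      g m ^ (a * m) * d * k ^ (n * m)         ≡⟨ *-assoc (g m ^ (a * m)) d (k ^ (n * m)) ⟩
      g m ^ (a * m) * (d * k ^ (n * m))       ≤⟨ *-monoʳ-≤ (g m ^ (a * m)) (d*k^t≤[1+k]^t k d (n * m) 1≤k kd≤nm) ⟩
      g m ^ (a * m) * suc k ^ (n * m)         ≤⟨ *-monoˡ-≤ (suc k ^ (n * m)) (^-monoʳ-≤ (g m) {{>-nonZero (g-pos m 1≤m)}} a*m≤n) ⟩
      g m ^ n * suc k ^ (n * m)               ∎
      where
      open ≤-Reasoning
      power-out : (g m ^ a * g 1 ^ m) ^ m ≡ g m ^ (a * m) * d
      power-out = trans (^-distribʳ-* (g m ^ a) (g 1 ^ m) m)
        (cong₂ _*_ (^-*-assoc (g m) a m) (^-*-assoc (g 1) m m))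
      kd≤nm : k * d ≤ n * m
      kd≤nm = ≤-trans kd≤n (m≤m*n n m)

open Fekete using (fekete)

RootInfLe-pointwise : ∀ {g h} → (∀ n → 1 ≤ n → g n ≤ h n) → RootInfLe g h
RootInfLe-pointwise g≤h m 1≤m k _ =
  m , 1≤m , *-mono-≤ (^-monoˡ-≤ m (g≤h m 1≤m)) (^-monoˡ-≤ (m * m) (n≤1+n k))

length-cartesianProductWith : ∀ {A B C : Set} (_∙_ : A → B → C) xs ys →
  length (cartesianProductWith _∙_ xs ys) ≡ length xs * length ys
length-cartesianProductWith _∙_ [] ys = refl
length-cartesianProductWith _∙_ (x ∷ xs) ys = trans (length-++ (map (x ∙_) ys))
  (cong₂ _+_ (length-map (x ∙_) ys) (length-cartesianProductWith _∙_ xs ys))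

skirts-++ : ∀ {m n q} {x₁ : Word m q} {x₂ : Word n q} {y : Word (m + n) q} →
  Skirts x₁ (take m y) → Skirts x₂ (drop m y) → Skirts (x₁ ++ x₂) y
skirts-++ {m} {y = y} s₁ s₂ i with splitAt m i in eq
... | inj₁ j = λ x≡y → s₁ j (trans x≡y (cong y (sym (splitAt⁻¹-↑ˡ eq))))
... | inj₂ j = λ x≡y → s₂ j (trans x≡y (cong y (sym (splitAt⁻¹-↑ʳ eq))))

skirting-++ : ∀ {m n q} {S : List (Word m q)} {T : List (Word n q)} →
  IsSkirting m q S → IsSkirting n q T → IsSkirting (m + n) q (cartesianProductWith _++_ S T)
skirting-++ {m} skS skT y with skS (take m y) | skT (drop m y)
... | x₁ , x₁∈S , s₁ | x₂ , x₂∈T , s₂ =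
  x₁ ++ x₂ , ∈-cartesianProductWith⁺ _++_ x₁∈S x₂∈T , skirts-++ s₁ s₂

-- pinch zero merges the symbols 0 and 1 of Fin (2 + q), so it is a left inverse of suc.
skirting-suc : ∀ {n q} {S : List (Word n (suc q))} →
  IsSkirting n (suc q) S → IsSkirting n (suc (suc q)) (map (suc ∘_) S)
skirting-suc skS y with skS (pinch zero ∘ y)
... | x , x∈S , s = suc ∘ x , ∈-map⁺ (suc ∘_) x∈S , λ i sx≡y → s i (cong (pinch zero) sx≡y)

module SkirtingNumber (f : ℕ → ℕ → ℕ)
  (f-min : ∀ n q → 1 ≤ n → 2 ≤ q → IsMinSkirtingSize n q (f n q)) where

  f≤length : ∀ {n q} {S : List (Word n q)} → 1 ≤ n → 2 ≤ q → IsSkirting n q S → f n q ≤ length S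
  f≤length {n} {q} {S} 1≤n 2≤q = proj₂ (f-min n q 1≤n 2≤q) S

  f-pos : ∀ q → 2 ≤ q → ∀ n → 1 ≤ n → 1 ≤ f n q
  f-pos q@(suc _) 2≤q n 1≤n with proj₁ (f-min n q 1≤n 2≤q)
  ... | S , skS , |S|≡f with skS (λ _ → zero)
  ... | _ , x∈S , _ = subst (1 ≤_) |S|≡f (∈-length x∈S)

  f-submult : ∀ q → 2 ≤ q → ∀ m n → 1 ≤ m → 1 ≤ n → f (m + n) q ≤ f m q * f n q
  f-submult q 2≤q m n 1≤m 1≤n with proj₁ (f-min m q 1≤m 2≤q) | proj₁ (f-min n q 1≤n 2≤q)
  ... | S , skS , |S|≡f | T , skT , |T|≡f =
    ≤-trans (f≤length (≤-trans 1≤m (m≤m+n m n)) 2≤q (skirting-++ skS skT))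
      (≤-reflexive (trans (length-cartesianProductWith _++_ S T) (cong₂ _*_ |S|≡f |T|≡f)))

  f-antitoneʳ : ∀ q → 2 ≤ q → ∀ n → 1 ≤ n → f n (suc q) ≤ f n q
  f-antitoneʳ q@(suc _) 2≤q n 1≤n with proj₁ (f-min n q 1≤n 2≤q)
  ... | S , skS , |S|≡f =
    ≤-trans (f≤length 1≤n (m≤n⇒m≤1+n 2≤q) (skirting-suc skS))
      (≤-reflexive (trans (length-map (suc ∘_) S) |S|≡f))

theorem2p1 : (f : ℕ → ℕ → ℕ) →
    ((n q : ℕ) → 1 ≤ n → 2 ≤ q → IsMinSkirtingSize n q (f n q)) →
    ((q : ℕ) → 2 ≤ q → RootLimitIsInf (λ n → f n q)) ×
    ((q : ℕ) → 2 ≤ q → RootInfLe (λ n → f n (suc q)) (λ n → f n q))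
theorem2p1 f f-min =
  (λ q 2≤q → fekete (λ n → f n q) (f-pos q 2≤q) (f-submult q 2≤q)) ,
  (λ q 2≤q → RootInfLe-pointwise (f-antitoneʳ q 2≤q))
  where open SkirtingNumber f f-min
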